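{- Let $r\ge 2$. If $T$ is a tree on $t\geq 3$ vertices and $\mathcal{T}$ is the $(r-2)$-expansion of $T$, then $\mathrm{Ext}(\mathcal{T})$ is sharply $(t+r-3)$-critical.
   Context: $r$-graph = $r$-uniform hypergraph. The $(r-2)$-expansion of a graph $G$ is obtained by adding $r-2$ new vertices and enlarging every edge of $G$ by these vertices. A pair of vertices is covered if it lies in some edge. $\mathrm{Ext}(\mathcal{G})$ is obtained by adding, for each uncovered pair $P$, $r-2$ new vertices (distinct for distinct pairs) and one edge consisting of $P$ and these vertices. $L_{\mathcal{H}}(v)=\{I:|I|=r-1, I\cup\{v\}\in\mathcal{H}\}$; $\mathcal{K}^{(k)}_p$ is the complete $k$-graph on $p$ vertices. Strongly $s$-colorable: vertices can be colored with $s$ colors so that no edge has two vertices of the same color. For $F\in\mathcal{H}$, $(\mathcal{H},F)$ is freely $s$-critical if $\mathcal{H}$ is not strongly $s$-colorable, $\mathcal{H}\setminus F$ is, and $r-2$ vertices of $F$ lie in no other edge; the remaining two vertices of $F$ are critical. $(\mathcal{H},F,v)$ with $v\in F$ is an $s$-spike if (i) $(\mathcal{H},F)$ is freely $s$-critical and $v$ is critical; (ii) $L_{\mathcal{H}}(v)$ is a matching; (iii) for every $\mathcal{S}\subseteq[s]^{(r-1)}$ with $|\mathcal{S}|\ge\binom{s-1}{r-1}$ not isomorphic to $\mathcal{K}^{(r-1)}_{s-1}$ there is $\varphi:V(\mathcal{H})\to[s]$ with $|\varphi(F')|=r$ for every edge $F'$ not containing $v$, and $|\varphi(I)|=r-1$,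 $\varphi(I)\in\mathcal{S}$ for all $I\in L_{\mathcal{H}}(v)$. $\mathcal{H}$ is sharply $s$-critical if some $(\mathcal{H},F,v)$ is an $s$-spike. -}

module Defs where

open import Level using (0ℓ) renaming (suc to lsuc)
open import Data.Nat using (ℕ; _≤_; _<_; _∸_; _+_)
open import Data.Nat.Combinatorics using (_C_)
open import Data.Bool using (Bool; true)
open import Data.Fin using (Fin; _↑ˡ_; _↑ʳ_) renaming (_<_ to _<ᶠ_)
open import Data.Fin.Properties using () renaming (_≟_ to _≟ᶠ_)
open import Data.Fin.Subset as Sub using (Subset; ⁅_⁆; _∪_; ∣_∣)
open import Data.List using (List; []; _∷_; _++_; map; foldr; filter; allFin; length; [_])
open import Data.List.Membership.Propositional using (_∈_; _∉_)
open import Data.List.Relation.Unary.All using (All)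
open import Data.List.Relation.Unary.Unique.Propositional using (Unique)
open import Data.List.Relation.Unary.Linked using (Linked)
open import Data.Product using (Σ; ∃; ∃-syntax; _×_; _,_; proj₁; proj₂)
open import Data.Sum using (_⊎_; inj₁; inj₂)
open import Data.Empty using (⊥)
open import Data.Refinement using (Refinement; Refinement-syntax; value) renaming (_≟_ to ≟-ref)
import Data.Sum.Properties as SumP
import Data.Product.Properties as ProdP
open import Relation.Binary.Definitions using (DecidableEquality)
open import Relation.Binary.PropositionalEquality using (_≡_; _≢_)
open import Relation.Nullary using (¬_; ¬?)
open import Function.Bundles using (_⇔_)

record Hypergraph : Set₁ where
  field
    V    : Set
    _≟_  : DecidableEquality V
    E    : Set
    vs   : E → List V
open Hypergraph public

_∖_ : (H : Hypergraph) → E H → Hypergraph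
H ∖ F = record { V = V H ; _≟_ = _≟_ H ; E = Σ (E H) (λ e → e ≢ F)
               ; vs = λ e → vs H (proj₁ e) }

image : ∀ {V : Set} {s} → (V → Fin s) → List V → Subset s
image φ = foldr (λ x A → ⁅ φ x ⁆ ∪ A) Sub.⊥

StronglyColorable : ℕ → Hypergraph → Set
StronglyColorable s H =
  Σ (V H → Fin s) λ φ → ∀ (e : E H) {u w : V H} → u ∈ vs H e → w ∈ vs H e → φ u ≡ φ w → u ≡ w

Covered : (H : Hypergraph) → V H → V H → Set
Covered H x y = ∃[ e ] (x ∈ vs H e × y ∈ vs H e)

-- (H , F) freely s-critical, with v one of the two critical vertices of F
-- (the r-2 vertices of F other than v and w lie in no other edge)
FreelyCriticalAt : ℕ → (H : Hypergraph) → E H → V H → Set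
FreelyCriticalAt s H F v =
  ¬ StronglyColorable s H × StronglyColorable s (H ∖ F) × v ∈ vs H F ×
  ∃[ w ] (w ∈ vs H F × w ≢ v ×
          (∀ u → u ∈ vs H F → u ≢ v → u ≢ w → ∀ e → u ∈ vs H e → e ≡ F))

linkSet : (H : Hypergraph) → V H → E H → List (V H)
linkSet H v e = filter (λ u → ¬? (_≟_ H u v)) (vs H e)

LinkMatching : (H : Hypergraph) → V H → Set
LinkMatching H v = ∀ e e' → v ∈ vs H e → v ∈ vs H e' → e ≢ e' →
  ∀ u → u ∈ linkSet H v e → u ∈ linkSet H v e' → ⊥

-- S ⊆ [s]^(r-1) (as an (r-1)-graph on [s]) is isomorphic to K^(r-1)_(s-1):
-- its edges are exactly the (r-1)-subsets of [s] ∖ {x} for some x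
IsoToCompleteMinusOne : (r s : ℕ) → List (Subset s) → Set
IsoToCompleteMinusOne r s S =
  ∃[ x ] ∀ (A : Subset s) → (A ∈ S) ⇔ (∣ A ∣ ≡ r ∸ 1 × x Sub.∉ A)

SpikeColouring : (r s : ℕ) (H : Hypergraph) → V H → List (Subset s) → Set
SpikeColouring r s H v S =
  Σ (V H → Fin s) λ φ → ((∀ F' → v ∉ vs H F' → ∣ image φ (vs H F') ∣ ≡ r) ×
          (∀ e → v ∈ vs H e → ∣ image φ (linkSet H v e) ∣ ≡ r ∸ 1
                             × image φ (linkSet H v e) ∈ S))

Spike : (r s : ℕ) (H : Hypergraph) → E H → V H → Set
Spike r s H F v =
  FreelyCriticalAt s H F v × LinkMatching H v ×
  (∀ (S : List (Subset s)) → Unique S → All (λ A → ∣ A ∣ ≡ r ∸ 1) S →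
     (s ∸ 1) C (r ∸ 1) ≤ length S → ¬ IsoToCompleteMinusOne r s S →
     SpikeColouring r s H v S)

SharplyCritical : (r s : ℕ) → Hypergraph → Set
SharplyCritical r s H = ∃[ F ] ∃[ v ] Spike r s H F v

module _ (r n : ℕ) (E₀ : Set) (vs₀ : E₀ → List (Fin n)) where
  private
    G₀ : Hypergraph
    G₀ = record { V = Fin n ; _≟_ = _≟ᶠ_ ; E = E₀ ; vs = vs₀ }

  -- unordered uncovered pairs {x , y}, represented with x < y
  UPair : Set
  UPair = [ p ∈ Fin n × Fin n ∣ (proj₁ p <ᶠ proj₂ p × ¬ Covered G₀ (proj₁ p) (proj₂ p)) ]

  ExtV : Set
  ExtV = Fin n ⊎ (UPair × Fin (r ∸ 2))

  ExtE : Set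
  ExtE = E₀ ⊎ UPair

  extVs : ExtE → List ExtV
  extVs (inj₁ e) = map inj₁ (vs₀ e)
  extVs (inj₂ p) = inj₁ (proj₁ (value p)) ∷ inj₁ (proj₂ (value p))
                   ∷ map (λ w → inj₂ (p , w)) (allFin (r ∸ 2))

  ExtG : Hypergraph
  ExtG = record { V = ExtV
                ; _≟_ = SumP.≡-dec _≟ᶠ_ (ProdP.≡-dec (≟-ref (ProdP.≡-dec _≟ᶠ_ _≟ᶠ_)) _≟ᶠ_)
                ; E = ExtE ; vs = extVs }

Ext : (r : ℕ) (n : ℕ) (E₀ : Set) → (E₀ → List (Fin n)) → Hypergraph
Ext r n E₀ vs₀ = ExtG r n E₀ vs₀

record SimpleGraph (t : ℕ) : Set where
  field
    adj     : Fin t → Fin t → Bool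
    sym     : ∀ x y → adj x y ≡ adj y x
    irrefl  : ∀ x → adj x x ≡ true → ⊥
open SimpleGraph public

Adj : ∀ {t} → SimpleGraph t → Fin t → Fin t → Set
Adj G x y = adj G x y ≡ true

data Walk {t} (G : SimpleGraph t) : Fin t → Fin t → Set where
  here : ∀ {x} → Walk G x x
  step : ∀ {x y z} → Adj G x y → Walk G y z → Walk G x z

Connected : ∀ {t} → SimpleGraph t → Set
Connected G = ∀ x y → Walk G x y

HasCycle : ∀ {t} → SimpleGraph t → Set
HasCycle G = ∃[ x ] ∃[ ys ] (2 ≤ length ys × Unique (x ∷ ys) ×
                               Linked (Adj G) (x ∷ ys ++ [ x ]))

IsTree : ∀ {t} → SimpleGraph t → Set
IsTree G = Connected G × ¬ HasCycle G

-- edges of a graph, each listed once as (a , b) with a < b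
GEdge : ∀ {t} → SimpleGraph t → Set
GEdge {t} G = [ p ∈ Fin t × Fin t ∣ (proj₁ p <ᶠ proj₂ p × Adj G (proj₁ p) (proj₂ p)) ]

-- the (r-2)-expansion of G: vertex set Fin (t + (r-2)), the first t being
-- the vertices of G and the last r-2 the new vertices
expVs : ∀ {t} (r : ℕ) (G : SimpleGraph t) → GEdge G → List (Fin (t + (r ∸ 2)))
expVs {t} r G p = (proj₁ (value p) ↑ˡ (r ∸ 2)) ∷ (proj₂ (value p) ↑ˡ (r ∸ 2))
                  ∷ map (t ↑ʳ_) (allFin (r ∸ 2))

ExtExpansion : ∀ {t} (r : ℕ) → SimpleGraph t → Hypergraph
ExtExpansion {t} r G = Ext r (t + (r ∸ 2)) (GEdge G) (expVs r G)

-- Take a leaf v of T with neighbour u and a third vertex x; the pair {v , x} is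
-- uncovered, and (Ext, F, v) is an s-spike for the edge F added for {v , x}:
--  * Ext(G) is not s-colourable for any r-graph G on s + 1 vertices (pigeonhole),
--    and Ext(G) minus an added edge is (merge the colours of its two ends);
--  * the link of v is a matching since v lies in one edge of the expansion;
--  * a family S as in the spike condition covers every colour (otherwise, by
--    counting, it would be all (r-1)-sets avoiding one colour); colour the link
--    of v at its expansion edge by some A ∈ S, and the new vertices of an added
--    edge {v , y} by a member of S containing the colour of y.

module Submission where

open import Defs hiding (sym)
open import Data.Nat using (ℕ; zero; suc; pred; _≤_; _<_; _+_; _∸_; z≤n; s≤s)
open import Data.Nat.Properties using (+-comm; +-suc; +-identityʳ; <-irrefl; <-≤-trans; m≤n+m; n≤1+n; n<1+n; m+n∸n≡m)
open import Data.Nat.Combinatorics using (_C_; nCk+nC[k+1]≡[n+1]C[k+1])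
open import Data.Bool using (true; false)
open import Data.Bool.Properties using () renaming (_≟_ to _≟ᵇ_)
open import Data.Vec using ([]; _∷_; insertAt)
open import Data.Vec.Properties using (≡-dec)
open import Data.Fin using (Fin; zero; suc; punchIn; punchOut; inject≤; splitAt; join; _↑ˡ_; _↑ʳ_) renaming (_<_ to _<ᶠ_)
open import Data.Fin.Properties as FinP using (punchIn-injective; punchInᵢ≢i; punchIn-punchOut; punchOut-injective)
  renaming (_≟_ to _≟ᶠ_)
open import Data.Fin.Subset as Sub using (Subset; ∣_∣; ⁅_⁆; _∪_; ∁)
open import Data.Fin.Subset.Properties as SubP using (_∈?_)
open import Data.Vec.Base using (here; there)
open import Data.List using (List; []; _∷_; _++_; length; [_]; map; allFin)
open import Data.List.Properties using (length-map; length-++; length-removeAt′; length-tabulate; ++-assoc)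
open import Data.List.Membership.Propositional using (_∈_; _∉_; find)
open import Data.List.Membership.Propositional.Properties using (∈-map⁺; ∈-map⁻; ∈-++⁺ˡ; ∈-++⁺ʳ; ∈-∃++; ∈-allFin; ∈-filter⁺; ∈-filter⁻)
open import Data.List.Relation.Unary.Any as Any using (Any; here; there; any?; index; _─_)
open import Data.List.Relation.Unary.All as All using (All; []; _∷_)
open import Data.List.Relation.Unary.All.Properties as AllP using (¬Any⇒All¬)
open import Data.List.Relation.Unary.Linked as Linked using (Linked; [-]; _∷_)
open import Data.List.Relation.Unary.AllPairs using ([]; _∷_)
open import Data.List.Relation.Unary.Unique.Propositional using (Unique)
import Data.List.Relation.Unary.Unique.Propositional.Properties as UniqueP
open import Data.Product using (Σ; ∃-syntax; _×_; _,_; proj₁; proj₂)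
open import Data.Sum as Sum using (_⊎_; inj₁; inj₂)
open import Data.Sum.Properties using (inj₁-injective; inj₂-injective)
import Data.Refinement as Ref
open import Data.Refinement using (Refinement; value; value-injective)
open import Data.Irrelevant using () renaming ([_] to irr[_])
open import Data.Empty using (⊥; ⊥-elim; ⊥-elim-irr)
open import Relation.Binary.Definitions using (tri<; tri≈; tri>)
open import Relation.Binary.PropositionalEquality using (_≡_; _≢_; refl; sym; trans; cong; cong₂; subst; module ≡-Reasoning)
open import Relation.Nullary using (¬_; yes; no; ¬?; _×-dec_; contradiction)
open import Function.Bundles using (mk⇔)

module _ {A : Set} where

  ─-keeps : ∀ {x z : A} (xs : List A) (p : x ∈ xs) → z ∈ xs → z ≢ x → z ∈ (xs ─ p)
  ─-keeps (_ ∷ xs) (here refl) (here refl) z≢x = ⊥-elim (z≢x refl)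
  ─-keeps (_ ∷ xs) (here refl) (there q)   _   = q
  ─-keeps (y ∷ xs) (there p)   (here refl) _   = here refl
  ─-keeps (y ∷ xs) (there p)   (there q)   z≢x = there (─-keeps xs p q z≢x)

  unique-length-≤ : ∀ (xs ys : List A) → Unique xs → (∀ {z} → z ∈ xs → z ∈ ys) →
                    length xs ≤ length ys
  unique-length-≤ []       ys _           _   = z≤n
  unique-length-≤ (x ∷ xs) ys (x∉xs ∷ u) xs⊆ys =
    subst (suc (length xs) ≤_) (sym (length-removeAt′ ys (index x∈ys)))
      (s≤s (unique-length-≤ xs (ys ─ x∈ys) u
              (λ z∈xs → ─-keeps ys x∈ys (xs⊆ys (there z∈xs)) (λ z≡x → All.lookup x∉xs z∈xs (sym z≡x)))))
    where x∈ys = xs⊆ys (here refl)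

  unique-length-< : ∀ (xs ys : List A) → Unique xs → (∀ {z} → z ∈ xs → z ∈ ys) →
                    ∀ {y} → y ∈ ys → y ∉ xs → length xs < length ys
  unique-length-< xs ys u xs⊆ys y∈ys y∉xs =
    unique-length-≤ (_ ∷ xs) ys (¬Any⇒All¬ xs y∉xs ∷ u)
      (λ { (here refl) → y∈ys ; (there z∈xs) → xs⊆ys z∈xs })

  unique-upTo : ∀ (l : List A) {y post} → Unique (l ++ y ∷ post) → Unique (l ++ [ y ])
  unique-upTo []      (_ ∷ _)        = [] ∷ []
  unique-upTo (x ∷ l) (x∉rest ∷ u) = AllP.∷ʳ⁺ (AllP.++⁻ˡ l x∉rest) (All.head (AllP.++⁻ʳ l x∉rest)) ∷ unique-upTo l u

  linked-upTo : ∀ {R : A → A → Set} (l : List A) {y h post} → Linked R (l ++ y ∷ post) → R y h →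
                Linked R (l ++ y ∷ [ h ])
  linked-upTo []          [-]          Ryh = Ryh ∷ [-]
  linked-upTo []          (_ ∷ _)      Ryh = Ryh ∷ [-]
  linked-upTo (x ∷ [])    (Rxy ∷ rest) Ryh = Rxy ∷ linked-upTo [] rest Ryh
  linked-upTo (x ∷ x' ∷ l) (Rxx' ∷ rest) Ryh = Rxx' ∷ linked-upTo (x' ∷ l) rest Ryh

subsetsOfSize : (m k : ℕ) → List (Subset m)
subsetsOfSize zero    zero    = [ [] ]
subsetsOfSize zero    (suc k) = []
subsetsOfSize (suc m) zero    = map (false ∷_) (subsetsOfSize m zero)
subsetsOfSize (suc m) (suc k) = map (false ∷_) (subsetsOfSize m (suc k)) ++ map (true ∷_) (subsetsOfSize m k)

subsetsOfSize-length : ∀ m k → length (subsetsOfSize m k) ≡ m C k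
subsetsOfSize-length zero    zero    = refl
subsetsOfSize-length zero    (suc k) = refl
subsetsOfSize-length (suc m) zero    = trans (length-map _ (subsetsOfSize m zero)) (subsetsOfSize-length m zero)
subsetsOfSize-length (suc m) (suc k) = begin
  length (map (false ∷_) (subsetsOfSize m (suc k)) ++ map (true ∷_) (subsetsOfSize m k))
    ≡⟨ length-++ (map (false ∷_) (subsetsOfSize m (suc k))) ⟩
  length (map (false ∷_) (subsetsOfSize m (suc k))) + length (map (true ∷_) (subsetsOfSize m k))
    ≡⟨ cong₂ _+_ (length-map _ (subsetsOfSize m (suc k))) (length-map _ (subsetsOfSize m k)) ⟩
  length (subsetsOfSize m (suc k)) + length (subsetsOfSize m k)
    ≡⟨ cong₂ _+_ (subsetsOfSize-length m (suc k)) (subsetsOfSize-length m k) ⟩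
  m C suc k + m C k
    ≡⟨ +-comm (m C suc k) (m C k) ⟩
  m C k + m C suc k
    ≡⟨ nCk+nC[k+1]≡[n+1]C[k+1] m k ⟩
  suc m C suc k ∎
  where open ≡-Reasoning

subsetsOfSize-complete : ∀ m k (A : Subset m) → ∣ A ∣ ≡ k → A ∈ subsetsOfSize m k
subsetsOfSize-complete zero    zero    []          _  = here refl
subsetsOfSize-complete (suc m) zero    (false ∷ A) eq = ∈-map⁺ (false ∷_) (subsetsOfSize-complete m zero A eq)
subsetsOfSize-complete (suc m) (suc k) (false ∷ A) eq =
  ∈-++⁺ˡ (∈-map⁺ (false ∷_) (subsetsOfSize-complete m (suc k) A eq))
subsetsOfSize-complete (suc m) (suc k) (true ∷ A)  eq =
  ∈-++⁺ʳ (map (false ∷_) (subsetsOfSize m (suc k))) (∈-map⁺ (true ∷_) (subsetsOfSize-complete m k A (cong pred eq)))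

avoiding-view : ∀ {m} (c : Fin (suc m)) (A : Subset (suc m)) → c Sub.∉ A →
                ∃[ B ] (A ≡ insertAt B c false × ∣ B ∣ ≡ ∣ A ∣)
avoiding-view zero    (true ∷ A)  c∉A = ⊥-elim (c∉A here)
avoiding-view zero    (false ∷ A) _   = A , refl , refl
avoiding-view {suc m} (suc c) (b ∷ A) c∉A with avoiding-view c A (λ c∈A → c∉A (there c∈A))
... | B , refl , size = b ∷ B , refl , sizeCons b B (insertAt B c false) size
  where
    sizeCons : ∀ {k l} b (B : Subset k) (A : Subset l) → ∣ B ∣ ≡ ∣ A ∣ → ∣ b ∷ B ∣ ≡ ∣ b ∷ A ∣
    sizeCons true  _ _ eq = cong suc eq
    sizeCons false _ _ eq = eq

subsetsAvoiding : (m k : ℕ) → Fin (suc m) → List (Subset (suc m))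
subsetsAvoiding m k c = map (λ B → insertAt B c false) (subsetsOfSize m k)

subsetsAvoiding-length : ∀ m k c → length (subsetsAvoiding m k c) ≡ m C k
subsetsAvoiding-length m k c = trans (length-map _ (subsetsOfSize m k)) (subsetsOfSize-length m k)

subsetsAvoiding-complete : ∀ m k c (A : Subset (suc m)) → ∣ A ∣ ≡ k → c Sub.∉ A → A ∈ subsetsAvoiding m k c
subsetsAvoiding-complete m k c A size c∉A with avoiding-view c A c∉A
... | B , refl , sizeB = ∈-map⁺ (λ B → insertAt B c false) (subsetsOfSize-complete m k B (trans sizeB size))

-- Otherwise S
-- would be a family of (r-1)-sets avoiding some c, i.e. a subfamily of
-- `subsetsAvoiding` of full size, hence all of it.
every-colour-covered : ∀ r s' (S : List (Subset (suc s'))) → Unique S → All (λ A → ∣ A ∣ ≡ r ∸ 1) S →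
                       s' C (r ∸ 1) ≤ length S → ¬ IsoToCompleteMinusOne r (suc s') S →
                       ∀ c → ∃[ B ] (B ∈ S × c Sub.∈ B)
every-colour-covered r s' S unique sizes large notIso c with any? (c ∈?_) S
... | yes c∈some = find c∈some
... | no c∈none = ⊥-elim (notIso (c , λ A → mk⇔ (λ A∈S → All.lookup sizes A∈S , c∉ A∈S) allIn))
  where
    c∉ : ∀ {A} → A ∈ S → c Sub.∉ A
    c∉ A∈S c∈A = c∈none (Any.map (λ A≡B → subst (c Sub.∈_) A≡B c∈A) A∈S)

    S⊆avoiding : ∀ {A} → A ∈ S → A ∈ subsetsAvoiding s' (r ∸ 1) c
    S⊆avoiding A∈S = subsetsAvoiding-complete s' (r ∸ 1) c _ (All.lookup sizes A∈S) (c∉ A∈S)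

    allIn : ∀ {A} → ∣ A ∣ ≡ r ∸ 1 × c Sub.∉ A → A ∈ S
    allIn {A} (size , c∉A) with any? (≡-dec _≟ᵇ_ A) S
    ... | yes A∈S = A∈S
    ... | no A∉S = ⊥-elim (<-irrefl refl (<-≤-trans tooShort large))
      where
        tooShort : length S < s' C (r ∸ 1)
        tooShort = subst (length S <_) (subsetsAvoiding-length s' (r ∸ 1) c)
                     (unique-length-< S _ unique S⊆avoiding (subsetsAvoiding-complete s' (r ∸ 1) c A size c∉A) A∉S)

module _ {V : Set} {s : ℕ} (φ : V → Fin s) where

  Rainbow : List V → Set
  Rainbow L = ∀ {u w} → u ∈ L → w ∈ L → φ u ≡ φ w → u ≡ w

  MapsOnto : (V → Set) → Subset s → Set
  MapsOnto P B = (∀ z → P z → φ z Sub.∈ B) × (∀ c → c Sub.∈ B → ∃[ z ] (P z × φ z ≡ c))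

  image-∈⁻ : ∀ (L : List V) {c} → c Sub.∈ image φ L → ∃[ z ] (z ∈ L × φ z ≡ c)
  image-∈⁻ []      c∈ = ⊥-elim (SubP.∉⊥ c∈)
  image-∈⁻ (x ∷ L) c∈ with SubP.x∈p∪q⁻ ⁅ φ x ⁆ (image φ L) c∈
  ... | inj₁ c∈⁅φx⁆ = x , here refl , sym (SubP.x∈⁅y⁆⇒x≡y (φ x) c∈⁅φx⁆)
  ... | inj₂ c∈rest with image-∈⁻ L c∈rest
  ...   | z , z∈L , φz≡c = z , there z∈L , φz≡c

  image-∈⁺ : ∀ (L : List V) {z} → z ∈ L → φ z Sub.∈ image φ L
  image-∈⁺ (x ∷ L) (here refl) = SubP.p⊆p∪q (image φ L) (SubP.x∈⁅x⁆ (φ x))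
  image-∈⁺ (x ∷ L) (there z∈L) = SubP.q⊆p∪q ⁅ φ x ⁆ (image φ L) (image-∈⁺ L z∈L)

  image-onto : ∀ (L : List V) (B : Subset s) → MapsOnto (_∈ L) B → image φ L ≡ B
  image-onto L B (into , onto) = SubP.⊆-antisym ⊆B B⊆
    where
      ⊆B : image φ L Sub.⊆ B
      ⊆B c∈ with image-∈⁻ L c∈
      ... | z , z∈L , refl = into z z∈L
      B⊆ : B Sub.⊆ image φ L
      B⊆ c∈B with onto _ c∈B
      ... | z , z∈L , refl = image-∈⁺ L z∈L

  image-size : ∀ (L : List V) → Unique L → Rainbow L → ∣ image φ L ∣ ≡ length L
  image-size []      _           _       = SubP.∣⊥∣≡0 s
  image-size (x ∷ L) (x∉L ∷ u) rainbow =
    trans (size-insert (φ x) (image φ L) φx∉)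
          (cong suc (image-size L u (λ u∈ w∈ → rainbow (there u∈) (there w∈))))
    where
      size-insert : ∀ {k} (a : Fin k) (p : Subset k) → a Sub.∉ p → ∣ ⁅ a ⁆ ∪ p ∣ ≡ suc ∣ p ∣
      size-insert zero    (true ∷ p)  a∉p = ⊥-elim (a∉p here)
      size-insert {suc k} zero    (false ∷ p) _   = cong (λ q → suc ∣ q ∣) (SubP.∪-identityˡ p)
      size-insert (suc a) (true ∷ p)  a∉p = cong suc (size-insert a p (λ a∈p → a∉p (there a∈p)))
      size-insert (suc a) (false ∷ p) a∉p = size-insert a p (λ a∈p → a∉p (there a∈p))

      φx∉ : φ x Sub.∉ image φ L
      φx∉ φx∈ with image-∈⁻ L φx∈
      ... | z , z∈L , φz≡φx = All.lookup x∉L z∈L (sym (rainbow (there z∈L) (here refl) φz≡φx))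

record Enumeration {m : ℕ} (k : ℕ) (B : Subset m) : Set where
  field
    elem           : Fin k → Fin m
    elem-injective : ∀ {i j} → elem i ≡ elem j → i ≡ j
    elem-∈         : ∀ i → elem i Sub.∈ B
    elem-onto      : ∀ {c} → c Sub.∈ B → ∃[ i ] elem i ≡ c

enumerate : ∀ {m} (B : Subset m) → Enumeration ∣ B ∣ B
enumerate {m} B = record { elem = list B ; elem-injective = injective B _ _
                         ; elem-∈ = list-∈ B ; elem-onto = onto B }
  where
    list : ∀ {k} (B : Subset k) → Fin ∣ B ∣ → Fin k
    list (true  ∷ B) zero    = zero
    list (true  ∷ B) (suc i) = suc (list B i)
    list (false ∷ B) i       = suc (list B i)

    injective : ∀ {k} (B : Subset k) i j → list B i ≡ list B j → i ≡ j
    injective (true  ∷ B) zero    zero    _  = refl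
    injective (true  ∷ B) (suc i) (suc j) eq = cong suc (injective B i j (FinP.suc-injective eq))
    injective (false ∷ B) i       j       eq = injective B i j (FinP.suc-injective eq)

    list-∈ : ∀ {k} (B : Subset k) i → list B i Sub.∈ B
    list-∈ (true  ∷ B) zero    = here
    list-∈ (true  ∷ B) (suc i) = there (list-∈ B i)
    list-∈ (false ∷ B) i       = there (list-∈ B i)

    onto : ∀ {k} (B : Subset k) {c} → c Sub.∈ B → ∃[ i ] list B i ≡ c
    onto (true  ∷ B) here      = zero , refl
    onto (true  ∷ B) (there p) with onto B p
    ... | i , eq = suc i , cong suc eq
    onto (false ∷ B) (there p) with onto B p
    ... | i , eq = i , cong suc eq

enumerate-sized : ∀ {m k} (B : Subset m) → ∣ B ∣ ≡ k → Enumeration k B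
enumerate-sized B refl = enumerate B

-- Colours for k new vertices avoiding two distinct colours c₁ , c₂ of
-- Fin (2 + m), for k ≤ m.  (When c₁ ≡ c₂ the value is irrelevant.)
avoidingTwo : ∀ {m k} → k ≤ m → Fin (suc (suc m)) → Fin (suc (suc m)) → Fin k → Fin (suc (suc m))
avoidingTwo k≤m c₁ c₂ w with c₁ ≟ᶠ c₂
... | yes _     = zero
... | no c₁≢c₂ = punchIn c₁ (punchIn (punchOut c₁≢c₂) (inject≤ w k≤m))

module _ {m k} (k≤m : k ≤ m) {c₁ c₂ : Fin (suc (suc m))} (c₁≢c₂ : c₁ ≢ c₂) where

  avoidingTwo-≢₁ : ∀ w → avoidingTwo k≤m c₁ c₂ w ≢ c₁
  avoidingTwo-≢₁ w with c₁ ≟ᶠ c₂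
  ... | yes c₁≡c₂ = ⊥-elim (c₁≢c₂ c₁≡c₂)
  ... | no _       = punchInᵢ≢i c₁ _

  avoidingTwo-≢₂ : ∀ w → avoidingTwo k≤m c₁ c₂ w ≢ c₂
  avoidingTwo-≢₂ w with c₁ ≟ᶠ c₂
  ... | yes c₁≡c₂ = ⊥-elim (c₁≢c₂ c₁≡c₂)
  ... | no ne     = λ eq → punchInᵢ≢i (punchOut ne) _
                      (punchIn-injective c₁ _ _ (trans eq (sym (punchIn-punchOut ne))))

  avoidingTwo-injective : ∀ w w' → avoidingTwo k≤m c₁ c₂ w ≡ avoidingTwo k≤m c₁ c₂ w' → w ≡ w'
  avoidingTwo-injective w w' with c₁ ≟ᶠ c₂
  ... | yes c₁≡c₂ = ⊥-elim (c₁≢c₂ c₁≡c₂)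
  ... | no ne     = λ eq → FinP.inject≤-injective k≤m k≤m w w'
                      (punchIn-injective (punchOut ne) _ _ (punchIn-injective c₁ _ _ eq))

punchOut₂ : ∀ {k} {v u a : Fin (suc (suc k))} → v ≢ u → v ≢ a → u ≢ a → Fin k
punchOut₂ v≢u v≢a u≢a = punchOut {i = punchOut v≢u} {j = punchOut v≢a} (λ eq → u≢a (punchOut-injective v≢u v≢a eq))

punchOut₂-injective : ∀ {k} {v u a b : Fin (suc (suc k))} (v≢u : v ≢ u)
                      (v≢a : v ≢ a) (u≢a : u ≢ a) (v≢b : v ≢ b) (u≢b : u ≢ b) →
                      punchOut₂ v≢u v≢a u≢a ≡ punchOut₂ v≢u v≢b u≢b → a ≡ b
punchOut₂-injective v≢u v≢a u≢a v≢b u≢b eq =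
  punchOut-injective v≢a v≢b
    (punchOut-injective (λ eq → u≢a (punchOut-injective v≢u v≢a eq)) (λ eq → u≢b (punchOut-injective v≢u v≢b eq)) eq)

[,]-injective : ∀ {A B C : Set} {f : A → C} {g : B → C} →
                (∀ {x y} → f x ≡ f y → x ≡ y) → (∀ {x y} → g x ≡ g y → x ≡ y) → (∀ x y → f x ≢ g y) →
                ∀ {x y} → Sum.[ f , g ]′ x ≡ Sum.[ f , g ]′ y → x ≡ y
[,]-injective f-inj g-inj disjoint {inj₁ x} {inj₁ y} eq = cong inj₁ (f-inj eq)
[,]-injective f-inj g-inj disjoint {inj₁ x} {inj₂ y} eq = ⊥-elim (disjoint x y eq)
[,]-injective f-inj g-inj disjoint {inj₂ x} {inj₁ y} eq = ⊥-elim (disjoint y x (sym eq))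
[,]-injective f-inj g-inj disjoint {inj₂ x} {inj₂ y} eq = cong inj₂ (g-inj eq)

-- Unordered pairs, represented as increasing ordered pairs with a property
-- (both the edges of a graph and the uncovered pairs are of this form)

module _ {k : ℕ} {P : Fin k × Fin k → Set} where

  private
    OrderedPair : Set
    OrderedPair = Refinement (Fin k × Fin k) (λ p → proj₁ p <ᶠ proj₂ p × P p)

  lo hi : OrderedPair → Fin k
  lo q = proj₁ (value q)
  hi q = proj₂ (value q)

  lo≢hi : ∀ q → lo q ≢ hi q
  lo≢hi (_ Ref., irr[ evidence ]) lo≡hi = ⊥-elim-irr (FinP.<⇒≢ (proj₁ evidence) lo≡hi)

  Joins : OrderedPair → Fin k → Fin k → Set
  Joins q a b = value q ≡ (a , b) ⊎ value q ≡ (b , a)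

  joins-distinct : ∀ q {a b} → Joins q a b → a ≢ b
  joins-distinct q (inj₁ refl) = lo≢hi q
  joins-distinct q (inj₂ refl) = λ eq → lo≢hi q (sym eq)

  joined-end : ∀ q {a b x} → Joins q a b → x ≡ lo q ⊎ x ≡ hi q → x ≡ a ⊎ x ≡ b
  joined-end q (inj₁ refl) end = end
  joined-end q (inj₂ refl) end = Sum.swap end

  joins-from-ends : ∀ q {a b} → a ≢ b → a ≡ lo q ⊎ a ≡ hi q → b ≡ lo q ⊎ b ≡ hi q → Joins q a b
  joins-from-ends q a≢b (inj₁ refl) (inj₁ refl) = ⊥-elim (a≢b refl)
  joins-from-ends q a≢b (inj₁ refl) (inj₂ refl) = inj₁ refl
  joins-from-ends q a≢b (inj₂ refl) (inj₁ refl) = inj₂ refl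
  joins-from-ends q a≢b (inj₂ refl) (inj₂ refl) = ⊥-elim (a≢b refl)

  joins-unique : ∀ q q' {a b} → Joins q a b → Joins q' a b → q ≡ q'
  joins-unique q q' (inj₁ eq) (inj₁ eq') = value-injective (trans eq (sym eq'))
  joins-unique q q' (inj₂ eq) (inj₂ eq') = value-injective (trans eq (sym eq'))
  joins-unique (_ Ref., irr[ ab ]) (_ Ref., irr[ ba ]) (inj₁ refl) (inj₂ refl) =
    ⊥-elim-irr (FinP.<-asym (proj₁ ab) (proj₁ ba))
  joins-unique (_ Ref., irr[ ba ]) (_ Ref., irr[ ab ]) (inj₂ refl) (inj₁ refl) =
    ⊥-elim-irr (FinP.<-asym (proj₁ ab) (proj₁ ba))

module _ {t : ℕ} (T : SimpleGraph t) where

  IsLeaf : Fin t → Fin t → Set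
  IsLeaf v u = Adj T v u × (∀ y → Adj T v y → y ≡ u)

  adj-sym : ∀ {x y} → Adj T x y → Adj T y x
  adj-sym {x} {y} xy = trans (SimpleGraph.sym T y x) xy

  SimplePath : List (Fin t) → Set
  SimplePath p = Unique p × Linked (Adj T) p

  -- In an acyclic graph the endpoint x of a simple path x y … is a leaf
  -- with neighbour y, or the path extends beyond x: a neighbour z ≠ y of x
  -- lying on the path would close a cycle.
  leaf-or-extend : ¬ HasCycle T → ∀ x y rest → SimplePath (x ∷ y ∷ rest) →
                   IsLeaf x y ⊎ ∃[ z ] (Adj T z x × z ∉ x ∷ y ∷ rest)
  leaf-or-extend acyclic x y rest (unique , linked)
    with any? (λ z → (adj T x z ≟ᵇ true) ×-dec ¬? (z ≟ᶠ y)) (allFin t)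
  ... | no noOther = inj₁ (Linked.head linked , onlyY)
    where
      onlyY : ∀ z → Adj T x z → z ≡ y
      onlyY z xz with z ≟ᶠ y
      ... | yes z≡y = z≡y
      ... | no z≢y = ⊥-elim (noOther (Any.map (λ { refl → xz , z≢y }) (∈-allFin z)))
  ... | yes other with Any.satisfied other
  ...   | z , xz , z≢y with any? (z ≟ᶠ_) (x ∷ y ∷ rest)
  ...     | no z∉path = inj₂ (z , adj-sym xz , z∉path)
  ...     | yes (here refl) = ⊥-elim (SimpleGraph.irrefl T x xz)
  ...     | yes (there (here z≡y)) = ⊥-elim (z≢y z≡y)
  ...     | yes (there (there z∈rest)) with ∈-∃++ z∈rest
  ...       | pre , post , refl = ⊥-elim (acyclic (x , y ∷ pre ++ [ z ] ,
                                                   s≤s (subst (1 ≤_) (sym (length-++ pre)) (m≤n+m 1 (length pre))) ,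
                                                   unique-upTo (x ∷ y ∷ pre) unique , closed))
    where
      closed : Linked (Adj T) (x ∷ y ∷ (pre ++ [ z ]) ++ [ x ])
      closed rewrite ++-assoc pre [ z ] [ x ] = linked-upTo (x ∷ y ∷ pre) linked (adj-sym xz)

  -- Extend a simple path at its endpoint until the endpoint is a leaf;
  -- the fuel bounds the number of extensions, since a simple path has at
  -- most t vertices.
  leaf-from-path : ¬ HasCycle T → (fuel : ℕ) → ∀ x y rest → SimplePath (x ∷ y ∷ rest) →
                   t < length (x ∷ y ∷ rest) + fuel → ∃[ v ] ∃[ u ] IsLeaf v u
  leaf-from-path acyclic zero x y rest (unique , _) tooLong =
    ⊥-elim (<-irrefl refl (<-≤-trans tooLong (subst (_≤ t) (sym (+-identityʳ _)) fitsIn)))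
    where
      fitsIn : length (x ∷ y ∷ rest) ≤ t
      fitsIn = subst (length (x ∷ y ∷ rest) ≤_) (length-tabulate (λ i → i))
                 (unique-length-≤ _ (allFin t) unique (λ _ → ∈-allFin _))
  leaf-from-path acyclic (suc fuel) x y rest path@(unique , linked) bound
    with leaf-or-extend acyclic x y rest path
  ... | inj₁ leaf = x , y , leaf
  ... | inj₂ (z , zx , z∉path) =
    leaf-from-path acyclic fuel z x (y ∷ rest) (¬Any⇒All¬ _ z∉path ∷ unique , zx ∷ linked)
      (subst (t <_) (+-suc (length (x ∷ y ∷ rest)) fuel) bound)

  -- start from an edge: vertex 0 has a neighbour since T is connected
  tree-has-leaf : IsTree T → 2 ≤ t → ∃[ v ] ∃[ u ] IsLeaf v u
  tree-has-leaf (connected , acyclic) (s≤s (s≤s _)) with connected zero (suc zero)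
  ... | step {y = z} 0z _ =
    leaf-from-path acyclic t z zero [] (((λ { refl → SimpleGraph.irrefl T zero 0z }) ∷ []) ∷ [] ∷ [] ,
                                        adj-sym 0z ∷ [-])
      (s≤s (n≤1+n _))

module ExtFacts (r' m : ℕ) (E₀ : Set) (vs₀ : E₀ → List (Fin (suc (suc (suc m))))) where

  s : ℕ
  s = suc (suc m)

  r : ℕ
  r = suc (suc r')

  H : Hypergraph
  H = Ext r (suc s) E₀ vs₀

  Pair : Set
  Pair = UPair r (suc s) E₀ vs₀

  new : Pair → Fin r' → V H
  new q w = inj₂ (q , w)

  UncoveredBy : Fin (suc s) → Fin (suc s) → Set
  UncoveredBy a b = ∀ e → a ∈ vs₀ e → b ∈ vs₀ e → ⊥

  -- the ends of a pair are uncovered (the evidence is irrelevant, so it is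
  -- only used to derive absurdity)
  joins-uncovered : ∀ (q : Pair) {a b} → Joins q a b → UncoveredBy a b
  joins-uncovered (_ Ref., irr[ evidence ]) (inj₁ refl) e a∈ b∈ = ⊥-elim-irr (proj₂ evidence (e , a∈ , b∈))
  joins-uncovered (_ Ref., irr[ evidence ]) (inj₂ refl) e a∈ b∈ = ⊥-elim-irr (proj₂ evidence (e , b∈ , a∈))

  pair-of : ∀ {a b} → a ≢ b → UncoveredBy a b → Σ Pair λ q → Joins q a b
  pair-of {a} {b} a≢b unc with FinP.<-cmp a b
  ... | tri< a<b _ _ = ((a , b) Ref., irr[ a<b , (λ (e , a∈ , b∈) → unc e a∈ b∈) ]) , inj₁ refl
  ... | tri≈ _ a≡b _ = ⊥-elim (a≢b a≡b)
  ... | tri> _ _ b<a = ((b , a) Ref., irr[ b<a , (λ (e , b∈ , a∈) → unc e a∈ b∈) ]) , inj₂ refl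

  ∈-baseEdge : ∀ e {z} → z ∈ vs H (inj₁ e) → ∃[ i ] (z ≡ inj₁ i × i ∈ vs₀ e)
  ∈-baseEdge e z∈ with ∈-map⁻ inj₁ z∈
  ... | i , i∈ , refl = i , refl , i∈

  ∈-pairEdge : ∀ q {z} → z ∈ vs H (inj₂ q) →
               z ≡ inj₁ (lo q) ⊎ z ≡ inj₁ (hi q) ⊎ ∃[ w ] (z ≡ new q w)
  ∈-pairEdge q (here eq)         = inj₁ eq
  ∈-pairEdge q (there (here eq)) = inj₂ (inj₁ eq)
  ∈-pairEdge q (there (there z∈)) with ∈-map⁻ (new q) z∈
  ... | w , _ , eq = inj₂ (inj₂ (w , eq))

  end-of : ∀ q {x} → inj₁ x ∈ vs H (inj₂ q) → x ≡ lo q ⊎ x ≡ hi q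
  end-of q x∈ with ∈-pairEdge q x∈
  ... | inj₁ eq           = inj₁ (inj₁-injective eq)
  ... | inj₂ (inj₁ eq)    = inj₂ (inj₁-injective eq)
  ... | inj₂ (inj₂ (_ , ()))

  not-an-end : ∀ q {x} → x ≢ lo q → x ≢ hi q → inj₁ x ∉ vs H (inj₂ q)
  not-an-end q x≢lo x≢hi x∈ with end-of q x∈
  ... | inj₁ x≡lo = x≢lo x≡lo
  ... | inj₂ x≡hi = x≢hi x≡hi

  ends-joined : ∀ q {a b} → Joins q a b → inj₁ a ∈ vs H (inj₂ q) × inj₁ b ∈ vs H (inj₂ q)
  ends-joined q (inj₁ refl) = here refl , there (here refl)
  ends-joined q (inj₂ refl) = there (here refl) , here refl

  new-private : ∀ q w e → new q w ∈ vs H e → e ≡ inj₂ q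
  new-private q w (inj₁ e)  w∈ with ∈-baseEdge e w∈
  ... | _ , () , _
  new-private q w (inj₂ q') w∈ with ∈-pairEdge q' w∈
  ... | inj₂ (inj₂ (_ , refl)) = refl

  pairEdge-unique : ∀ q → Unique (vs H (inj₂ q))
  pairEdge-unique q = ((λ eq → lo≢hi q (inj₁-injective eq)) ∷ AllP.map⁺ (All.tabulate λ _ ()))
                    ∷ AllP.map⁺ (All.tabulate λ _ ()) ∷ UniqueP.map⁺ (λ { refl → refl }) (UniqueP.allFin⁺ r')

  pairEdge-length : ∀ q → length (vs H (inj₂ q)) ≡ r
  pairEdge-length q = cong (λ k → suc (suc k)) (trans (length-map (new q) (allFin r')) (length-tabulate (λ i → i)))

  -- Ext(G) is not strongly s-colourable: two of its s + 1 old vertices get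
  -- the same colour, and they lie together in a base edge or a pair edge.
  not-colourable : ¬ StronglyColorable s H
  not-colourable (φ , proper) with FinP.pigeonhole (n<1+n s) (λ i → φ (inj₁ i))
  ... | i , j , i<j , same = FinP.<⇒≢ i<j (inj₁-injective (proper (inj₂ q) (proj₁ ends) (proj₂ ends) same))
    where
      unc : UncoveredBy i j
      unc e i∈ j∈ = FinP.<⇒≢ i<j (inj₁-injective (proper (inj₁ e) (∈-map⁺ inj₁ i∈) (∈-map⁺ inj₁ j∈) same))

      pairOfEnds : Σ Pair λ q → Joins q i j
      pairOfEnds = pair-of (FinP.<⇒≢ i<j) unc

      q : Pair
      q = proj₁ pairOfEnds

      ends : inj₁ i ∈ vs H (inj₂ q) × inj₁ j ∈ vs H (inj₂ q)
      ends = ends-joined q (proj₂ pairOfEnds)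

  baseEdge-rainbow : ∀ (φ : V H → Fin s) e → (∀ {i j} → i ∈ vs₀ e → j ∈ vs₀ e → φ (inj₁ i) ≡ φ (inj₁ j) → i ≡ j) →
                     Rainbow φ (vs H (inj₁ e))
  baseEdge-rainbow φ e distinct z∈ z'∈ same with ∈-baseEdge e z∈ | ∈-baseEdge e z'∈
  ... | i , refl , i∈ | j , refl , j∈ = cong inj₁ (distinct i∈ j∈ same)

  module _ (r'≤m : r' ≤ m) where

    pairEdge-rainbow : ∀ (φ : V H → Fin s) q → φ (inj₁ (lo q)) ≢ φ (inj₁ (hi q)) →
                       (∀ w → φ (new q w) ≡ avoidingTwo r'≤m (φ (inj₁ (lo q))) (φ (inj₁ (hi q))) w) →
                       Rainbow φ (vs H (inj₂ q))
    pairEdge-rainbow φ q ends≢ newColours z∈ z'∈ = cases (∈-pairEdge q z∈) (∈-pairEdge q z'∈)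
      where
        ≢lo : ∀ w → φ (new q w) ≢ φ (inj₁ (lo q))
        ≢lo w eq = avoidingTwo-≢₁ r'≤m ends≢ w (trans (sym (newColours w)) eq)
        ≢hi : ∀ w → φ (new q w) ≢ φ (inj₁ (hi q))
        ≢hi w eq = avoidingTwo-≢₂ r'≤m ends≢ w (trans (sym (newColours w)) eq)

        cases : ∀ {z z'} → z ≡ inj₁ (lo q) ⊎ z ≡ inj₁ (hi q) ⊎ ∃[ w ] (z ≡ new q w) →
                z' ≡ inj₁ (lo q) ⊎ z' ≡ inj₁ (hi q) ⊎ ∃[ w ] (z' ≡ new q w) → φ z ≡ φ z' → z ≡ z'
        cases (inj₁ refl)               (inj₁ refl)               _  = refl
        cases (inj₁ refl)               (inj₂ (inj₁ refl))        eq = ⊥-elim (ends≢ eq)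
        cases (inj₁ refl)               (inj₂ (inj₂ (w , refl)))  eq = ⊥-elim (≢lo w (sym eq))
        cases (inj₂ (inj₁ refl))        (inj₁ refl)               eq = ⊥-elim (ends≢ (sym eq))
        cases (inj₂ (inj₁ refl))        (inj₂ (inj₁ refl))        _  = refl
        cases (inj₂ (inj₁ refl))        (inj₂ (inj₂ (w , refl)))  eq = ⊥-elim (≢hi w (sym eq))
        cases (inj₂ (inj₂ (w , refl)))  (inj₁ refl)               eq = ⊥-elim (≢lo w eq)
        cases (inj₂ (inj₂ (w , refl)))  (inj₂ (inj₁ refl))        eq = ⊥-elim (≢hi w eq)
        cases (inj₂ (inj₂ (w , refl)))  (inj₂ (inj₂ (w' , refl))) eq =
          cong (new q) (avoidingTwo-injective r'≤m ends≢ w w'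
                          (trans (sym (newColours w)) (trans eq (newColours w'))))

    -- Ext(G) minus the edge of an uncovered pair p is strongly s-colourable:
    -- give the two ends of p the same colour and all other old vertices
    -- distinct colours; the new vertices avoid the colours of their ends.
    minus-colourable : ∀ p → StronglyColorable s (H ∖ inj₂ p)
    minus-colourable p = φ , proper
      where
        merge : Fin (suc s) → Fin s
        merge i with lo p ≟ᶠ i
        ... | yes _     = punchOut (lo≢hi p)
        ... | no lo≢i = punchOut lo≢i

        merge-injective : ∀ i j → merge i ≡ merge j → i ≡ j ⊎ Joins p i j
        merge-injective i j eq with lo p ≟ᶠ i | lo p ≟ᶠ j
        ... | yes refl | yes refl = inj₁ refl
        ... | yes refl | no lo≢j = inj₂ (inj₁ (cong (lo p ,_) (punchOut-injective (lo≢hi p) lo≢j eq)))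
        ... | no lo≢i  | yes refl = inj₂ (inj₂ (cong (lo p ,_) (sym (punchOut-injective lo≢i (lo≢hi p) eq))))
        ... | no lo≢i  | no lo≢j = inj₁ (punchOut-injective lo≢i lo≢j eq)

        φ : V H → Fin s
        φ (inj₁ i)       = merge i
        φ (inj₂ (q , w)) = avoidingTwo r'≤m (merge (lo q)) (merge (hi q)) w

        proper : ∀ (e : E (H ∖ inj₂ p)) → Rainbow φ (vs (H ∖ inj₂ p) e)
        proper (inj₁ e , _) = baseEdge-rainbow φ e distinct
          where
            distinct : ∀ {i j} → i ∈ vs₀ e → j ∈ vs₀ e → merge i ≡ merge j → i ≡ j
            distinct {i} {j} i∈ j∈ same with merge-injective i j same
            ... | inj₁ i≡j = i≡j
            ... | inj₂ joins = ⊥-elim (joins-uncovered p joins e i∈ j∈)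
        proper (inj₂ q , q≢p) = pairEdge-rainbow φ q ends≢ (λ _ → refl)
          where
            ends≢ : merge (lo q) ≢ merge (hi q)
            ends≢ same with merge-injective (lo q) (hi q) same
            ... | inj₁ lo≡hi = lo≢hi q lo≡hi
            ... | inj₂ joins = q≢p (cong inj₂ (joins-unique q p (inj₁ refl) joins))

    -- (Ext(G) , p) is freely s-critical for every uncovered pair p = {a , b},
    -- with a critical: its new vertices lie in no other edge.
    freely-critical : ∀ p {a b} → Joins p a b → FreelyCriticalAt s H (inj₂ p) (inj₁ a)
    freely-critical p {a} {b} joins =
      not-colourable , minus-colourable p , proj₁ (ends-joined p joins) ,
      inj₁ b , proj₂ (ends-joined p joins) , (λ b≡a → joins-distinct p joins (sym (inj₁-injective b≡a))) ,
      newOnly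
      where
        notJoined : ∀ {x} → inj₁ x ≢ inj₁ a → inj₁ x ≢ inj₁ b → ¬ (x ≡ a ⊎ x ≡ b)
        notJoined x≢a _   (inj₁ refl) = x≢a refl
        notJoined _   x≢b (inj₂ refl) = x≢b refl

        newOnly : ∀ z → z ∈ vs H (inj₂ p) → z ≢ inj₁ a → z ≢ inj₁ b → ∀ e → z ∈ vs H e → e ≡ inj₂ p
        newOnly z z∈ z≢a z≢b e z∈e with ∈-pairEdge p z∈
        ... | inj₁ refl               = ⊥-elim (notJoined z≢a z≢b (joined-end p joins (inj₁ refl)))
        ... | inj₂ (inj₁ refl)        = ⊥-elim (notJoined z≢a z≢b (joined-end p joins (inj₂ refl)))
        ... | inj₂ (inj₂ (w , refl)) = new-private p w e z∈e

  ∈-link⁻ : ∀ x e {z} → z ∈ linkSet H x e → z ∈ vs H e × z ≢ x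
  ∈-link⁻ x e = ∈-filter⁻ (λ u → ¬? (_≟_ H u x)) {xs = vs H e}

  ∈-link⁺ : ∀ x e {z} → z ∈ vs H e → z ≢ x → z ∈ linkSet H x e
  ∈-link⁺ x e = ∈-filter⁺ (λ u → ¬? (_≟_ H u x)) {xs = vs H e}

  pair-through : ∀ q {v i} → inj₁ v ∈ vs H (inj₂ q) → inj₁ i ∈ vs H (inj₂ q) → i ≢ v → Joins q v i
  pair-through q v∈ i∈ i≢v = joins-from-ends q (λ v≡i → i≢v (sym v≡i)) (end-of q v∈) (end-of q i∈)

  -- the links of v at a base edge and at a pair edge are disjoint, since
  -- the base edge would cover the pair
  base-pair-disjoint : ∀ e q {v} → inj₁ v ∈ vs H (inj₁ e) → inj₁ v ∈ vs H (inj₂ q) →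
                       ∀ z → z ∈ linkSet H (inj₁ v) (inj₁ e) → z ∈ vs H (inj₂ q) → ⊥
  base-pair-disjoint e q {v} v∈ v∈q z z∈link z∈q with ∈-link⁻ (inj₁ v) (inj₁ e) z∈link
  ... | z∈ , z≢v with ∈-baseEdge e z∈ | ∈-baseEdge e v∈
  ...   | i , refl , i∈ | _ , refl , v∈₀ =
    joins-uncovered q (pair-through q v∈q z∈q (λ i≡v → z≢v (cong inj₁ i≡v))) e v∈₀ i∈

  -- The link of an old vertex v is a matching as soon as v lies in at most
  -- one base edge: besides the case of two base edges, two pair edges
  -- through v sharing an old vertex i are both the pair {v , i}, and they
  -- cannot share a new vertex.
  link-matching : ∀ v → (∀ e e' → v ∈ vs₀ e → v ∈ vs₀ e' → e ≡ e') → LinkMatching H (inj₁ v)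
  link-matching v single (inj₁ e) (inj₁ e') v∈ v∈' e≢e' _ _ _ =
    e≢e' (cong inj₁ (single e e' (old∈ e v∈) (old∈ e' v∈')))
    where
      old∈ : ∀ e {i} → inj₁ i ∈ vs H (inj₁ e) → i ∈ vs₀ e
      old∈ e i∈ with ∈-baseEdge e i∈
      ... | _ , refl , i∈₀ = i∈₀
  link-matching v single (inj₁ e) (inj₂ q) v∈ v∈q _ z z∈ z∈q =
    base-pair-disjoint e q v∈ v∈q z z∈ (proj₁ (∈-link⁻ (inj₁ v) (inj₂ q) z∈q))
  link-matching v single (inj₂ q) (inj₁ e) v∈q v∈ _ z z∈q z∈ =
    base-pair-disjoint e q v∈ v∈q z z∈ (proj₁ (∈-link⁻ (inj₁ v) (inj₂ q) z∈q))
  link-matching v single (inj₂ q) (inj₂ q') v∈q v∈q' q≢q' (inj₁ i) i∈q i∈q'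
    with ∈-link⁻ (inj₁ v) (inj₂ q) i∈q | ∈-link⁻ (inj₁ v) (inj₂ q') i∈q'
  ... | i∈ , inj₁i≢v | i∈' , _ =
    q≢q' (cong inj₂ (joins-unique q q' (pair-through q v∈q i∈ i≢v) (pair-through q' v∈q' i∈' i≢v)))
    where
      i≢v : i ≢ v
      i≢v i≡v = inj₁i≢v (cong inj₁ i≡v)
  link-matching v single (inj₂ q) (inj₂ q') v∈q v∈q' q≢q' (inj₂ (q'' , w)) w∈q w∈q' =
    q≢q' (trans (new-private q'' w (inj₂ q) (proj₁ (∈-link⁻ (inj₁ v) (inj₂ q) w∈q)))
                (sym (new-private q'' w (inj₂ q') (proj₁ (∈-link⁻ (inj₁ v) (inj₂ q') w∈q')))))

  -- New vertices of a pair {v , y} take the colours of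
  -- a member of S containing ψ y other than ψ y; new vertices of the other
  -- pairs avoid the colours of their two ends.
  module SpikeColouringAt
    (r'≤m : r' ≤ m) (v : Fin (suc s)) (S : List (Subset s))
    (sizes : All (λ A → ∣ A ∣ ≡ suc r') S) (covered : ∀ c → ∃[ B ] (B ∈ S × c Sub.∈ B))
    (ψ : Fin (suc s) → Fin s) (ψ-injective : ∀ {i j} → i ≢ v → j ≢ v → ψ i ≡ ψ j → i ≡ j)
    (base-unique : ∀ e → Unique (vs₀ e)) (base-length : ∀ e → length (vs₀ e) ≡ r)
    (base-link : ∀ e → v ∈ vs₀ e → ∃[ A ] (A ∈ S × MapsOnto ψ (λ i → i ∈ vs₀ e × i ≢ v) A))
    where

    block : Fin s → Subset s
    block c = proj₁ (covered c)

    block∈S : ∀ c → block c ∈ S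
    block∈S c = proj₁ (proj₂ (covered c))

    listing : ∀ c → Enumeration (suc r') (block c)
    listing c = enumerate-sized (block c) (All.lookup sizes (block∈S c))

    position : ∀ c → ∃[ k ] Enumeration.elem (listing c) k ≡ c
    position c = Enumeration.elem-onto (listing c) (proj₂ (proj₂ (covered c)))

    others : Fin s → Fin r' → Fin s
    others c w = Enumeration.elem (listing c) (punchIn (proj₁ (position c)) w)

    data Through (q : Pair) : Set where
      through : ∀ y → y ≢ v → Joins q v y → Through q
      avoids  : v ≢ lo q → v ≢ hi q → Through q

    through? : ∀ q → Through q
    through? q with v ≟ᶠ lo q | v ≟ᶠ hi q
    ... | yes v≡lo | _        = through (hi q) (λ hi≡v → lo≢hi q (trans (sym v≡lo) (sym hi≡v)))
                                  (inj₁ (cong (_, hi q) (sym v≡lo)))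
    ... | no _     | yes v≡hi = through (lo q) (λ lo≡v → lo≢hi q (trans lo≡v v≡hi))
                                  (inj₂ (cong (lo q ,_) (sym v≡hi)))
    ... | no v≢lo  | no v≢hi  = avoids v≢lo v≢hi

    newColour : ∀ q → Through q → Fin r' → Fin s
    newColour q (through y _ _) = others (ψ y)
    newColour q (avoids _ _)    = avoidingTwo r'≤m (ψ (lo q)) (ψ (hi q))

    φ : V H → Fin s
    φ (inj₁ i)       = ψ i
    φ (inj₂ (q , w)) = newColour q (through? q) w

    rainbow-away : ∀ e → inj₁ v ∉ vs H e → Rainbow φ (vs H e)
    rainbow-away (inj₁ e) v∉ = baseEdge-rainbow φ e (λ i∈ j∈ → ψ-injective (≢v i∈) (≢v j∈))
      where
        ≢v : ∀ {i} → i ∈ vs₀ e → i ≢ v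
        ≢v i∈ refl = v∉ (∈-map⁺ inj₁ i∈)
    rainbow-away (inj₂ q) v∉ with through? q in eq
    ... | through _ _ joins = ⊥-elim (v∉ (proj₁ (ends-joined q joins)))
    ... | avoids v≢lo v≢hi  = pairEdge-rainbow r'≤m φ q ends≢ (λ w → cong (λ th → newColour q th w) eq)
      where
        ends≢ : ψ (lo q) ≢ ψ (hi q)
        ends≢ same = lo≢hi q (ψ-injective (λ lo≡v → v≢lo (sym lo≡v)) (λ hi≡v → v≢hi (sym hi≡v)) same)

    edge-unique : ∀ e → Unique (vs H e)
    edge-unique (inj₁ e) = UniqueP.map⁺ inj₁-injective (base-unique e)
    edge-unique (inj₂ q) = pairEdge-unique q

    edge-length : ∀ e → length (vs H e) ≡ r
    edge-length (inj₁ e) = trans (length-map inj₁ (vs₀ e)) (base-length e)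
    edge-length (inj₂ q) = pairEdge-length q

    link-onto : ∀ e → inj₁ v ∈ vs H e → ∃[ B ] (B ∈ S × MapsOnto φ (_∈ linkSet H (inj₁ v) e) B)
    link-onto (inj₁ e) v∈ with ∈-baseEdge e v∈
    ... | _ , refl , v∈₀ with base-link e v∈₀
    ...   | A , A∈S , into , onto = A , A∈S , into′ , onto′
      where
        into′ : ∀ z → z ∈ linkSet H (inj₁ v) (inj₁ e) → φ z Sub.∈ A
        into′ z z∈ with ∈-link⁻ (inj₁ v) (inj₁ e) z∈
        ... | z∈e , z≢v with ∈-baseEdge e z∈e
        ...   | i , refl , i∈ = into i (i∈ , λ i≡v → z≢v (cong inj₁ i≡v))

        onto′ : ∀ c → c Sub.∈ A → ∃[ z ] (z ∈ linkSet H (inj₁ v) (inj₁ e) × φ z ≡ c)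
        onto′ c c∈ with onto c c∈
        ... | i , (i∈ , i≢v) , ψi≡c =
          inj₁ i , ∈-link⁺ (inj₁ v) (inj₁ e) (∈-map⁺ inj₁ i∈) (λ eq → i≢v (inj₁-injective eq)) , ψi≡c
    link-onto (inj₂ q) v∈ with through? q in eq
    ... | avoids v≢lo v≢hi = ⊥-elim (not-an-end q v≢lo v≢hi v∈)
    ... | through y y≢v joins = block (ψ y) , block∈S (ψ y) , into , onto
      where
        open Enumeration (listing (ψ y))

        newColours : ∀ w → φ (new q w) ≡ others (ψ y) w
        newColours w = cong (λ th → newColour q th w) eq

        into : ∀ z → z ∈ linkSet H (inj₁ v) (inj₂ q) → φ z Sub.∈ block (ψ y)
        into (inj₁ i) i∈link with ∈-link⁻ (inj₁ v) (inj₂ q) i∈link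
        ... | i∈ , i≢v with joined-end q joins (end-of q i∈)
        ...   | inj₁ refl = ⊥-elim (i≢v refl)
        ...   | inj₂ refl = proj₂ (proj₂ (covered (ψ y)))
        into (inj₂ (q' , w)) w∈link with new-private q' w (inj₂ q) (proj₁ (∈-link⁻ (inj₁ v) (inj₂ q) w∈link))
        ... | refl = subst (Sub._∈ block (ψ y)) (sym (newColours w)) (elem-∈ _)

        onto : ∀ c → c Sub.∈ block (ψ y) → ∃[ z ] (z ∈ linkSet H (inj₁ v) (inj₂ q) × φ z ≡ c)
        onto c c∈ with elem-onto c∈
        ... | k , refl with proj₁ (position (ψ y)) ≟ᶠ k
        ...   | yes refl =
          inj₁ y , ∈-link⁺ (inj₁ v) (inj₂ q) (proj₂ (ends-joined q joins)) (λ eq → y≢v (inj₁-injective eq)) ,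
          sym (proj₂ (position (ψ y)))
        ...   | no k≢ =
          new q (punchOut k≢) ,
          ∈-link⁺ (inj₁ v) (inj₂ q) (there (there (∈-map⁺ (new q) (∈-allFin _)))) (λ ()) ,
          trans (newColours (punchOut k≢)) (cong elem (punchIn-punchOut k≢))

    spike-colouring : SpikeColouring r s H (inj₁ v) S
    spike-colouring = φ , away , near
      where
        away : ∀ F' → inj₁ v ∉ vs H F' → ∣ image φ (vs H F') ∣ ≡ r
        away F' v∉ = trans (image-size φ (vs H F') (edge-unique F') (rainbow-away F' v∉)) (edge-length F')

        near : ∀ e → inj₁ v ∈ vs H e →
               ∣ image φ (linkSet H (inj₁ v) e) ∣ ≡ r ∸ 1 × image φ (linkSet H (inj₁ v) e) ∈ S
        near e v∈ with link-onto e v∈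
        ... | B , B∈S , onto with image-onto φ (linkSet H (inj₁ v) e) B onto
        ...   | image≡B = trans (cong ∣_∣ image≡B) (All.lookup sizes B∈S) , subst (_∈ S) (sym image≡B) B∈S

module Expansion (r' t' : ℕ) (T : SimpleGraph (suc (suc (suc t')))) where

  t : ℕ
  t = suc (suc (suc t'))

  open ExtFacts r' (t' + r') (GEdge T) (expVs (suc (suc r')) T) public

  edgeVs : GEdge T → List (Fin (t + r'))
  edgeVs = expVs (suc (suc r')) T

  old : Fin t → Fin (t + r')
  old a = a ↑ˡ r'

  core : Fin r' → Fin (t + r')
  core w = t ↑ʳ w

  old≢core : ∀ a w → old a ≢ core w
  old≢core a w eq with trans (sym (FinP.splitAt-↑ˡ t a r')) (trans (cong (splitAt t) eq) (FinP.splitAt-↑ʳ t r' w))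
  ... | ()

  ∈-edge : ∀ ge {i} → i ∈ edgeVs ge → i ≡ old (lo ge) ⊎ i ≡ old (hi ge) ⊎ ∃[ w ] (i ≡ core w)
  ∈-edge ge (here eq)         = inj₁ eq
  ∈-edge ge (there (here eq)) = inj₂ (inj₁ eq)
  ∈-edge ge (there (there i∈)) with ∈-map⁻ core i∈
  ... | w , _ , eq = inj₂ (inj₂ (w , eq))

  old-end : ∀ ge {a} → old a ∈ edgeVs ge → a ≡ lo ge ⊎ a ≡ hi ge
  old-end ge a∈ with ∈-edge ge a∈
  ... | inj₁ eq              = inj₁ (FinP.↑ˡ-injective r' _ _ eq)
  ... | inj₂ (inj₁ eq)       = inj₂ (FinP.↑ˡ-injective r' _ _ eq)
  ... | inj₂ (inj₂ (w , eq)) = ⊥-elim (old≢core _ w eq)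

  ends-in-edge : ∀ ge {a b} → Joins ge a b → old a ∈ edgeVs ge × old b ∈ edgeVs ge
  ends-in-edge ge (inj₁ refl) = here refl , there (here refl)
  ends-in-edge ge (inj₂ refl) = there (here refl) , here refl

  edge-unique : ∀ ge → Unique (edgeVs ge)
  edge-unique ge = ((λ eq → lo≢hi ge (FinP.↑ˡ-injective r' _ _ eq)) ∷ AllP.map⁺ (All.tabulate λ _ → old≢core (lo ge) _))
                 ∷ AllP.map⁺ (All.tabulate λ _ → old≢core (hi ge) _)
                 ∷ UniqueP.map⁺ (FinP.↑ʳ-injective t _ _) (UniqueP.allFin⁺ r')

  edge-length : ∀ ge → length (edgeVs ge) ≡ r
  edge-length ge = cong (λ k → suc (suc k)) (trans (length-map core (allFin r')) (length-tabulate (λ i → i)))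

  -- the ends of an edge of T are adjacent; adjacency being decidable, this
  -- is recovered from the irrelevant evidence
  ends-adjacent : ∀ (ge : GEdge T) → Adj T (lo ge) (hi ge)
  ends-adjacent ge@(_ Ref., irr[ evidence ]) with adj T (lo ge) (hi ge) ≟ᵇ true
  ... | yes adjacent   = adjacent
  ... | no notAdjacent = ⊥-elim-irr (notAdjacent (proj₂ evidence))

  covered⇒adjacent : ∀ {a b} → a ≢ b → ∀ ge → old a ∈ edgeVs ge → old b ∈ edgeVs ge → Adj T a b
  covered⇒adjacent a≢b ge a∈ b∈ with joins-from-ends ge a≢b (old-end ge a∈) (old-end ge b∈)
  ... | inj₁ refl = ends-adjacent ge
  ... | inj₂ refl = adj-sym T (ends-adjacent ge)

  module AtLeaf {v u : Fin t} (leaf : IsLeaf T v u) where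

    v≢u : v ≢ u
    v≢u refl = SimpleGraph.irrefl T v (proj₁ leaf)

    leaf-edge : ∀ ge → old v ∈ edgeVs ge → Joins ge v u
    leaf-edge ge v∈ with old-end ge v∈
    ... | inj₁ refl = inj₁ (cong (lo ge ,_) (proj₂ leaf (hi ge) (ends-adjacent ge)))
    ... | inj₂ refl = inj₂ (cong (_, hi ge) (proj₂ leaf (lo ge) (adj-sym T (ends-adjacent ge))))

    single-edge : ∀ ge ge' → old v ∈ edgeVs ge → old v ∈ edgeVs ge' → ge ≡ ge'
    single-edge ge ge' v∈ v∈' = joins-unique ge ge' (leaf-edge ge v∈) (leaf-edge ge' v∈')

    leaf-uncovered : ∀ {x} → x ≢ v → x ≢ u → UncoveredBy (old v) (old x)
    leaf-uncovered x≢v x≢u ge v∈ x∈ = x≢u (proj₂ leaf _ (covered⇒adjacent (λ v≡x → x≢v (sym v≡x)) ge v∈ x∈))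

    -- Given an (r-1)-set A of colours, colour the old vertices injectively
    -- away from v so that the link of v, namely u and the core, gets the
    -- colours of A: u (and v) the first colour of A, the core the others,
    -- and the remaining t - 2 tree vertices the s - (r-1) colours outside A.
    module LeafColouring (A : Subset s) (sizeA : ∣ A ∣ ≡ suc r') where

      open Enumeration (enumerate-sized A sizeA)
        renaming (elem to inA; elem-injective to inA-injective; elem-∈ to inA-∈; elem-onto to inA-onto)
      open Enumeration (enumerate-sized (∁ A) (trans (SubP.∣∁p∣≡n∸∣p∣ A)
                         (trans (cong (s ∸_) sizeA) (m+n∸n≡m (suc t') r'))))
        renaming (elem to outA; elem-injective to outA-injective; elem-∈ to outA-∈)

      treeLabel : Fin t → Fin (suc r') ⊎ Fin (suc t')
      treeLabel a with u ≟ᶠ a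
      ... | yes _ = inj₁ zero
      ... | no u≢a with v ≟ᶠ a
      ...   | yes _    = inj₁ zero
      ...   | no v≢a = inj₂ (punchOut₂ v≢u v≢a u≢a)

      treeLabel-u : treeLabel u ≡ inj₁ zero
      treeLabel-u with u ≟ᶠ u
      ... | yes _   = refl
      ... | no u≢u = ⊥-elim (u≢u refl)

      treeLabel-injective : ∀ {a b} → a ≢ v → b ≢ v → treeLabel a ≡ treeLabel b → a ≡ b
      treeLabel-injective {a} {b} a≢v b≢v eq with u ≟ᶠ a | u ≟ᶠ b
      ... | yes refl | yes refl = refl
      ... | yes refl | no u≢b with v ≟ᶠ b
      ...   | yes refl = ⊥-elim (b≢v refl)
      ...   | no _     = contradiction eq λ ()
      treeLabel-injective {a} {b} a≢v b≢v eq | no u≢a | yes refl with v ≟ᶠ a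
      ...   | yes refl = ⊥-elim (a≢v refl)
      ...   | no _     = contradiction eq λ ()
      treeLabel-injective {a} {b} a≢v b≢v eq | no u≢a | no u≢b with v ≟ᶠ a | v ≟ᶠ b
      ...   | yes refl | _        = ⊥-elim (a≢v refl)
      ...   | no _     | yes refl = ⊥-elim (b≢v refl)
      ...   | no v≢a   | no v≢b   = punchOut₂-injective v≢u v≢a u≢a v≢b u≢b (inj₂-injective eq)

      treeLabel-not-core : ∀ a w → treeLabel a ≢ inj₁ (suc w)
      treeLabel-not-core a w with u ≟ᶠ a
      ... | yes _ = λ ()
      ... | no _ with v ≟ᶠ a
      ...   | yes _ = λ ()
      ...   | no _  = λ ()

      splitLabel : Fin t ⊎ Fin r' → Fin (suc r') ⊎ Fin (suc t')
      splitLabel = Sum.[ treeLabel , (λ w → inj₁ (suc w)) ]′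

      splitLabel-injective : ∀ {x y} → x ≢ inj₁ v → y ≢ inj₁ v → splitLabel x ≡ splitLabel y → x ≡ y
      splitLabel-injective {inj₁ a} {inj₁ b} a≢v b≢v eq =
        cong inj₁ (treeLabel-injective (λ a≡v → a≢v (cong inj₁ a≡v)) (λ b≡v → b≢v (cong inj₁ b≡v)) eq)
      splitLabel-injective {inj₁ a} {inj₂ w} _ _ eq = ⊥-elim (treeLabel-not-core a w eq)
      splitLabel-injective {inj₂ w} {inj₁ a} _ _ eq = ⊥-elim (treeLabel-not-core a w (sym eq))
      splitLabel-injective {inj₂ w} {inj₂ w'} _ _ eq = cong inj₂ (FinP.suc-injective (inj₁-injective eq))

      ψ : Fin (t + r') → Fin s
      ψ i = Sum.[ inA , outA ]′ (splitLabel (splitAt t i))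

      ψ-injective : ∀ {i j} → i ≢ old v → j ≢ old v → ψ i ≡ ψ j → i ≡ j
      ψ-injective {i} {j} i≢v j≢v eq = splitAt-injective
        (splitLabel-injective (not-v i≢v) (not-v j≢v)
          ([,]-injective inA-injective outA-injective (λ k k' inA≡outA → SubP.x∈∁p⇒x∉p (outA-∈ k')
                                                        (subst (Sub._∈ A) inA≡outA (inA-∈ k))) eq))
        where
          not-v : ∀ {i} → i ≢ old v → splitAt t i ≢ inj₁ v
          not-v i≢v split≡ = i≢v (sym (FinP.splitAt⁻¹-↑ˡ split≡))
          splitAt-injective : ∀ {i j} → splitAt t i ≡ splitAt t j → i ≡ j
          splitAt-injective {i} {j} eq =
            trans (sym (FinP.join-splitAt t r' i)) (trans (cong (join t r') eq) (FinP.join-splitAt t r' j))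

      ψ-u : ψ (old u) ≡ inA zero
      ψ-u rewrite FinP.splitAt-↑ˡ t u r' | treeLabel-u = refl

      ψ-core : ∀ w → ψ (core w) ≡ inA (suc w)
      ψ-core w rewrite FinP.splitAt-↑ʳ t r' w = refl

      link-onto : ∀ ge → old v ∈ edgeVs ge → MapsOnto ψ (λ i → i ∈ edgeVs ge × i ≢ old v) A
      link-onto ge v∈ = into , onto
        where
          joins : Joins ge v u
          joins = leaf-edge ge v∈

          endColour : ∀ {a} → a ≡ v ⊎ a ≡ u → old a ≢ old v → ψ (old a) Sub.∈ A
          endColour (inj₁ refl) a≢v = ⊥-elim (a≢v refl)
          endColour (inj₂ refl) _   = subst (Sub._∈ A) (sym ψ-u) (inA-∈ zero)

          into : ∀ i → i ∈ edgeVs ge × i ≢ old v → ψ i Sub.∈ A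
          into i (i∈ , i≢v) with ∈-edge ge i∈
          ... | inj₂ (inj₂ (w , refl)) = subst (Sub._∈ A) (sym (ψ-core w)) (inA-∈ (suc w))
          ... | inj₁ refl        = endColour (joined-end ge joins (inj₁ refl)) i≢v
          ... | inj₂ (inj₁ refl) = endColour (joined-end ge joins (inj₂ refl)) i≢v

          onto : ∀ c → c Sub.∈ A → ∃[ i ] ((i ∈ edgeVs ge × i ≢ old v) × ψ i ≡ c)
          onto c c∈ with inA-onto c∈
          ... | zero , refl  = old u , (proj₂ (ends-in-edge ge joins) ,
                                        λ u≡v → v≢u (sym (FinP.↑ˡ-injective r' u v u≡v))) , ψ-u
          ... | suc w , refl = core w , (there (there (∈-map⁺ core (∈-allFin w))) ,
                                        λ core≡v → old≢core v w (sym core≡v)) , ψ-core w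

    -- a third tree vertex x (here t ≥ 3 is used); x is not adjacent to v
    x : Fin t
    x = avoidingTwo (s≤s z≤n) v u zero

    x≢v : x ≢ v
    x≢v = avoidingTwo-≢₁ (s≤s z≤n) v≢u zero

    critical : Σ Pair λ q → Joins q (old v) (old x)
    critical = pair-of (λ v≡x → x≢v (sym (FinP.↑ˡ-injective r' v x v≡x)))
                       (leaf-uncovered x≢v (avoidingTwo-≢₂ (s≤s z≤n) v≢u zero))

    -- every family S as in the spike condition admits a spike colouring at
    -- v: S covers all colours, and any member A of S serves for the link
    -- of v at its base edge
    spike-condition : ∀ (S : List (Subset s)) → Unique S → All (λ A → ∣ A ∣ ≡ r ∸ 1) S →
                      (s ∸ 1) C (r ∸ 1) ≤ length S → ¬ IsoToCompleteMinusOne r s S →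
                      SpikeColouring r s H (inj₁ (old v)) S
    spike-condition S unique sizes large notIso = spike-colouring
      where
        covered : ∀ c → ∃[ B ] (B ∈ S × c Sub.∈ B)
        covered = every-colour-covered r (suc (t' + r')) S unique sizes large notIso

        A : Subset s
        A = proj₁ (covered zero)

        A∈S : A ∈ S
        A∈S = proj₁ (proj₂ (covered zero))

        open LeafColouring A (All.lookup sizes A∈S)
        open SpikeColouringAt (m≤n+m r' t') (old v) S sizes covered ψ ψ-injective edge-unique edge-length
                              (λ ge v∈ → A , A∈S , link-onto ge v∈)
          using (spike-colouring)

lemma4p1 : (r t : ℕ) → 2 ≤ r → 3 ≤ t → (T : SimpleGraph t) → IsTree T →
           SharplyCritical r (t + r ∸ 3) (ExtExpansion r T)
lemma4p1 (suc (suc r')) (suc (suc (suc t'))) (s≤s (s≤s z≤n)) (s≤s (s≤s (s≤s z≤n))) T tree =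
  subst (λ k → SharplyCritical (suc (suc r')) k (ExtExpansion (suc (suc r')) T)) (sym colours)
    ( inj₂ (proj₁ critical) , inj₁ (old v)
    , freely-critical (m≤n+m r' t') (proj₁ critical) (proj₂ critical)
    , link-matching (old v) single-edge
    , spike-condition )
  where
    open Expansion r' t' T

    leafOf : ∃[ v ] ∃[ u ] IsLeaf T v u
    leafOf = tree-has-leaf T tree (s≤s (s≤s z≤n))

    v : Fin t
    v = proj₁ leafOf
    open AtLeaf (proj₂ (proj₂ leafOf))

    colours : t' + suc (suc r') ≡ s
    colours = trans (+-suc t' (suc r')) (cong suc (+-suc t' r'))
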